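{- Let $k$ be a positive integer and let $L_k$ denote the linear equation \[ \sum_{i=1}^{k-1} \frac{2^i}{2^i-1} x_i = \left( -1 + \sum_{i=1}^{k-1} \frac{2^i}{2^i-1} \right) x_0 \] in the variables $x_0, x_1, \dots, x_{k-1}$. Then $L_k$ is $(k-1)$-regular but not $k$-regular. That is, every coloring of the positive integers with $k-1$ colors admits a monochromatic solution to $L_k$, while there exists a coloring of the positive integers with $k$ colors admitting no monochromatic solution to $L_k$.
   Context: A linear equation $L$ is called $k$-regular if every $k$-coloring of the positive integers (i.e., every map from the positive integers to a set of $k$ colors) contains a monochromatic solution to $L$, meaning an assignment of positive integers to all the variables of $L$ satisfying $L$ such that all assigned values receive the same color. The values of the variables in a solution are not required to be distinct. -}

module Defs where

open import Data.Nat as ℕ using (ℕ; zero; suc; _^_; _∸_; _≤_; s≤s; z≤n; NonZero)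
open import Data.Nat.Properties using (^-monoʳ-<; m<n⇒0<n∸m)
open import Data.Integer using (+_)
open import Data.Rational using (ℚ; _/_; _+_; _*_; -_; 0ℚ; 1ℚ)
open import Data.Fin using (Fin; zero; suc)
open import Data.Product using (Σ; _×_)
open import Relation.Binary.PropositionalEquality using (_≡_)

pow2-1-nonZero : ∀ j → NonZero (2 ^ suc j ∸ 1)
pow2-1-nonZero j = ℕ.>-nonZero (m<n⇒0<n∸m (^-monoʳ-< 2 (s≤s (s≤s z≤n)) {0} {suc j} (s≤s z≤n)))

-- the coefficient 2^i / (2^i - 1) for i = j + 1 ≥ 1
coef : ℕ → ℚ
coef j = _/_ (+ (2 ^ suc j)) (2 ^ suc j ∸ 1) {{pow2-1-nonZero j}}

Σℚ : (n : ℕ) → (Fin n → ℚ) → ℚ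
Σℚ zero    f = 0ℚ
Σℚ (suc n) f = f zero + Σℚ n (λ i → f (suc i))

toℚ : ℕ → ℚ
toℚ n = (+ n) / 1

-- The equation L_k for k = suc m, in variables x₀ = x zero, x_i = x (suc (i-1)) (1 ≤ i ≤ m = k-1):
--   Σ_{i=1}^{k-1} 2^i/(2^i-1) x_i = (-1 + Σ_{i=1}^{k-1} 2^i/(2^i-1)) x₀
IsSolutionL : (m : ℕ) → (Fin (suc m) → ℕ) → Set
IsSolutionL m x =
  Σℚ m (λ i → coef (Data.Fin.toℕ i) * toℚ (x (suc i)))
    ≡ ((- 1ℚ) + Σℚ m (λ i → coef (Data.Fin.toℕ i))) * toℚ (x zero)

-- A coloring is a map ℕ → Fin r;
-- its value at 0 is irrelevant since all solution values are positive.
Regular : (m r : ℕ) → Set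
Regular m r =
  (χ : ℕ → Fin r) →
  Σ (Fin (suc m) → ℕ) λ x →
    ((i : Fin (suc m)) → 1 ≤ x i) ×
    IsSolutionL m x ×
    ((i : Fin (suc m)) → χ (x i) ≡ χ (x zero))

module Submission where

-- Not k-regular: colour n by ν₂(n) mod k, ν₂ the 2-adic valuation.  In a
-- monochromatic solution all ν₂(x_i) are congruent mod k, and ν₂(c_i) = i, so the
-- left-hand terms c_i x_i have pairwise distinct valuations i + ν₂(x_i), none equal
-- to ν₂(x₀); the right-hand side has valuation ν₂(x₀), because -1 + Σ c_i has
-- valuation 0.  By the ultrametric property LHS - RHS then has a valuation, so it
-- is nonzero, a contradiction.
-- (k-1)-regular: two of 2⁰, …, 2^(k-1), say 2^a and 2^(a+i), share a colour; then
-- x_i = 2^a and all other variables 2^(a+i) is a solution, as c_i (2^(a+i) - 2^a) = 2^(a+i).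

open import Data.Nat as ℕ using (ℕ; zero; suc; _^_; _∸_; _≤_; _<_; s≤s; z≤n; NonZero)
import Data.Nat.Properties as ℕP
open import Data.Nat.DivMod using (_%_; _/_; _mod_; m<n⇒m%n≡m; [m+kn]%n≡m%n; m≡m%n+[m/n]*n)
open import Data.Nat.Induction using (<-rec)
open import Data.Integer as ℤ using (ℤ; +_; _+_; _*_; -_; 0ℤ; 1ℤ)
import Data.Integer.Properties as ℤP
open import Data.Integer.Tactic.RingSolver using (solve-∀)
open import Data.Rational as ℚ using (ℚ; toℚᵘ; 0ℚ; 1ℚ)
import Data.Rational.Properties as ℚP
open import Data.Rational.Solver using (module +-*-Solver)
open import Data.Rational.Unnormalised as ℚᵘ using (ℚᵘ; mkℚᵘ; *≡*) renaming (_≃_ to _≃ᵘ_)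
import Data.Rational.Unnormalised.Properties as ℚᵘP
open import Data.Fin as F using (Fin; zero; suc; toℕ)
import Data.Fin.Properties as FP
open import Data.Product using (Σ; _×_; _,_; proj₁; proj₂)
open import Data.Sum using (_⊎_; inj₁; inj₂)
open import Data.Empty using (⊥; ⊥-elim)
open import Function using (_∘_)
open import Relation.Nullary using (¬_; contradiction)
open import Relation.Binary.Definitions using (tri<; tri≈; tri>)
open import Relation.Binary.PropositionalEquality hiding (J)
open ≡-Reasoning

open import Defs

-- Arithmetic on
-- ℚ normalises by gcd; through the ring homomorphism toℚᵘ we may instead
-- compute with explicit numerators and denominators.
_≐_ : ℚ → ℚᵘ → Set
q ≐ r = toℚᵘ q ≃ᵘ r

≐-/ : ∀ i d .{{_ : NonZero d}} → (i ℚ./ d) ≐ mkℚᵘ i (ℕ.pred d)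
≐-/ i (suc d) = ℚP.toℚᵘ-fromℚᵘ (mkℚᵘ i d)

≐-+ : ∀ {p q r s} → p ≐ r → q ≐ s → (p ℚ.+ q) ≐ (r ℚᵘ.+ s)
≐-+ {p} {q} p≐r q≐s = ℚᵘP.≃-trans (ℚP.toℚᵘ-homo-+ p q) (ℚᵘP.+-cong p≐r q≐s)

≐-* : ∀ {p q r s} → p ≐ r → q ≐ s → (p ℚ.* q) ≐ (r ℚᵘ.* s)
≐-* {p} {q} p≐r q≐s = ℚᵘP.≃-trans (ℚP.toℚᵘ-homo-* p q) (ℚᵘP.*-cong p≐r q≐s)

≐-neg : ∀ {p r} → p ≐ r → (ℚ.- p) ≐ (ℚᵘ.- r)
≐-neg {p} p≐r = ℚᵘP.≃-trans (ℚP.toℚᵘ-homo‿- p) (ℚᵘP.-‿cong p≐r)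

≐-unique : ∀ {p q r s} → p ≐ r → q ≐ s → r ≃ᵘ s → p ≡ q
≐-unique p≐r q≐s r≃s = ℚP.toℚᵘ-injective (ℚᵘP.≃-trans p≐r (ℚᵘP.≃-trans r≃s (ℚᵘP.≃-sym q≐s)))

toℚ-≐ : ∀ n → toℚ n ≐ mkℚᵘ (+ n) 0
toℚ-≐ n = ≐-/ (+ n) 1

≐-num : ∀ {q N N' d} → N ≡ N' → q ≐ mkℚᵘ N d → q ≐ mkℚᵘ N' d
≐-num refl q≐r = q≐r

Odd : ℤ → ℤ
Odd a = 1ℤ + + 2 * a

pow2 : ℕ → ℤ
pow2 e = + (2 ^ e)

-- Odd integers are nonzero: 1 + 2a = 0 would give 2·|a| = 1.
Odd≢0 : ∀ a → Odd a ≢ 0ℤ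
Odd≢0 a odd≡0 = ℕP.even≢odd ℤ.∣ - a ∣ 0 (begin
  2 ℕ.* ℤ.∣ - a ∣  ≡⟨ ℤP.abs-* (+ 2) (- a) ⟨
  ℤ.∣ + 2 * - a ∣  ≡⟨ cong ℤ.∣_∣ (trans (shift a) (cong (λ z → - z + 1ℤ) odd≡0)) ⟩
  1                ∎)
  where
  shift : ∀ a → + 2 * - a ≡ - (1ℤ + + 2 * a) + 1ℤ
  shift = solve-∀

pow2≢0 : ∀ e → pow2 e ≢ 0ℤ
pow2≢0 e 2^e≡0 = ℕP.<⇒≢ (ℕP.m^n>0 2 e) (sym (ℤP.+-injective 2^e≡0))

pow2-+ : ∀ e f → pow2 (e ℕ.+ f) ≡ pow2 e * pow2 f
pow2-+ e f = trans (cong +_ (ℕP.^-distribˡ-+-* 2 e f)) (ℤP.pos-* (2 ^ e) (2 ^ f))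

-- The 2-adic valuation of a nonzero rational, as a relation:
-- `HasVal2 e q` says q = 2^e · (odd) / (odd), i.e. ν₂(q) = e.
record HasVal2 (e : ℕ) (q : ℚ) : Set where
  constructor val2
  field
    numOdd   : ℤ
    den-1    : ℕ
    denOdd   : ℤ
    fraction : q ≐ mkℚᵘ (Odd numOdd * pow2 e) den-1
    oddDen   : + suc den-1 ≡ Odd denOdd

val2⇒≢0 : ∀ {e q} → HasVal2 e q → q ≢ 0ℚ
val2⇒≢0 {e} (val2 a d b (*≡* eq) _) refl with ℤP.i*j≡0⇒i≡0∨j≡0 (Odd a) (sym (trans eq (ℤP.*-identityʳ _)))
... | inj₁ odd≡0 = Odd≢0 a odd≡0
... | inj₂ 2^e≡0 = pow2≢0 e 2^e≡0

oddMul : ℤ → ℤ → ℤ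
oddMul a b = a + b + + 2 * a * b

Odd-* : ∀ a b → Odd a * Odd b ≡ Odd (oddMul a b)
Odd-* = expanded
  where
  expanded : ∀ a b → (1ℤ + + 2 * a) * (1ℤ + + 2 * b) ≡ 1ℤ + + 2 * (a + b + + 2 * a * b)
  expanded = solve-∀

oddDen-* : ∀ {d₁ d₂} b₁ b₂ → + suc d₁ ≡ Odd b₁ → + suc d₂ ≡ Odd b₂ →
           + (suc d₁ ℕ.* suc d₂) ≡ Odd (oddMul b₁ b₂)
oddDen-* {d₁} {d₂} b₁ b₂ o₁ o₂ = begin
  + (suc d₁ ℕ.* suc d₂)  ≡⟨ ℤP.pos-* (suc d₁) (suc d₂) ⟩
  + suc d₁ * + suc d₂    ≡⟨ cong₂ _*_ o₁ o₂ ⟩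
  Odd b₁ * Odd b₂        ≡⟨ Odd-* b₁ b₂ ⟩
  Odd (oddMul b₁ b₂)     ∎

val2-* : ∀ {e f p q} → HasVal2 e p → HasVal2 f q → HasVal2 (e ℕ.+ f) (p ℚ.* q)
val2-* {e} {f} (val2 a₁ _ b₁ fr₁ o₁) (val2 a₂ _ b₂ fr₂ o₂) =
  val2 (oddMul a₁ a₂) _ (oddMul b₁ b₂) (≐-num numerator (≐-* fr₁ fr₂)) (oddDen-* b₁ b₂ o₁ o₂)
  where
  regroup : ∀ u v x y → u * x * (v * y) ≡ (u * v) * (x * y)
  regroup = solve-∀
  numerator : Odd a₁ * pow2 e * (Odd a₂ * pow2 f) ≡ Odd (oddMul a₁ a₂) * pow2 (e ℕ.+ f)
  numerator = begin
    Odd a₁ * pow2 e * (Odd a₂ * pow2 f)            ≡⟨ regroup (Odd a₁) (Odd a₂) (pow2 e) (pow2 f) ⟩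
    (Odd a₁ * Odd a₂) * (pow2 e * pow2 f)          ≡⟨ cong₂ _*_ (Odd-* a₁ a₂) (sym (pow2-+ e f)) ⟩
    Odd (oddMul a₁ a₂) * pow2 (e ℕ.+ f) ∎

val2-neg : ∀ {e p} → HasVal2 e p → HasVal2 e (ℚ.- p)
val2-neg {e} (val2 a d b fr o) = val2 (- (1ℤ + a)) d b (≐-num (negate a (pow2 e)) (≐-neg fr)) o
  where
  negate : ∀ a x → - ((1ℤ + + 2 * a) * x) ≡ (1ℤ + + 2 * (- (1ℤ + a))) * x
  negate = solve-∀

val2-+-< : ∀ {e f p q} → e < f → HasVal2 e p → HasVal2 f q → HasVal2 e (p ℚ.+ q)
val2-+-< {e} {f} e<f (val2 a₁ d₁ b₁ fr₁ o₁) (val2 a₂ d₂ b₂ fr₂ o₂) =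
  val2 (oddMul a₁ b₂ + pow2 g * Odd a₂ * Odd b₁) _ (oddMul b₁ b₂)
       (≐-num numerator (≐-+ fr₁ fr₂)) (oddDen-* b₁ b₂ o₁ o₂)
  where
  g = f ∸ suc e
  pow2-f : pow2 f ≡ pow2 e * (+ 2 * pow2 g)
  pow2-f = begin
    pow2 f                        ≡⟨ cong pow2 (ℕP.m+[n∸m]≡n e<f) ⟨
    pow2 (suc e ℕ.+ g)            ≡⟨ cong pow2 (ℕP.+-suc e g) ⟨
    pow2 (e ℕ.+ suc g)            ≡⟨ pow2-+ e (suc g) ⟩
    pow2 e * pow2 (suc g)         ≡⟨ cong (pow2 e *_) (ℤP.pos-* 2 (2 ^ g)) ⟩
    pow2 e * (+ 2 * pow2 g)       ∎
  factor : ∀ a₁ b₁ u v x y →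
           (1ℤ + + 2 * a₁) * x * (1ℤ + + 2 * b₁) + u * (x * (+ 2 * y)) * v ≡
           (1ℤ + + 2 * (a₁ + b₁ + + 2 * a₁ * b₁ + y * u * v)) * x
  factor = solve-∀
  numerator : Odd a₁ * pow2 e * + suc d₂ + Odd a₂ * pow2 f * + suc d₁ ≡
              Odd (oddMul a₁ b₂ + pow2 g * Odd a₂ * Odd b₁) * pow2 e
  numerator = begin
    Odd a₁ * pow2 e * + suc d₂ + Odd a₂ * pow2 f * + suc d₁
      ≡⟨ cong₂ (λ x y → Odd a₁ * pow2 e * x + Odd a₂ * pow2 f * y) o₂ o₁ ⟩
    Odd a₁ * pow2 e * Odd b₂ + Odd a₂ * pow2 f * Odd b₁
      ≡⟨ cong (λ z → Odd a₁ * pow2 e * Odd b₂ + Odd a₂ * z * Odd b₁) pow2-f ⟩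
    Odd a₁ * pow2 e * Odd b₂ + Odd a₂ * (pow2 e * (+ 2 * pow2 g)) * Odd b₁
      ≡⟨ factor a₁ b₂ (Odd a₂) (Odd b₁) (pow2 e) (pow2 g) ⟩
    Odd (oddMul a₁ b₂ + pow2 g * Odd a₂ * Odd b₁) * pow2 e ∎

val2-+-> : ∀ {e f p q} → f < e → HasVal2 e p → HasVal2 f q → HasVal2 f (p ℚ.+ q)
val2-+-> {f = f} {p} {q} f<e vp vq = subst (HasVal2 f) (ℚP.+-comm q p) (val2-+-< f<e vq vp)

ZeroOrVal2 : (ℕ → Set) → ℚ → Set
ZeroOrVal2 A q = q ≡ 0ℚ ⊎ Σ ℕ λ v → A v × HasVal2 v q

zeroOrVal2-map : ∀ {A B : ℕ → Set} {q} → (∀ {v} → A v → B v) → ZeroOrVal2 A q → ZeroOrVal2 B q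
zeroOrVal2-map A⇒B (inj₁ q≡0)          = inj₁ q≡0
zeroOrVal2-map A⇒B (inj₂ (v , av , h)) = inj₂ (v , A⇒B av , h)

val2-+-dominant : ∀ {w p q} → HasVal2 w p → ZeroOrVal2 (w <_) q → HasVal2 w (p ℚ.+ q)
val2-+-dominant {w} {p} vp (inj₁ refl)          = subst (HasVal2 w) (sym (ℚP.+-identityʳ p)) vp
val2-+-dominant         vp (inj₂ (v , w<v , vq)) = val2-+-< w<v vp vq

val2-+-≢ : ∀ {w p q} → ZeroOrVal2 (_≢ w) p → HasVal2 w q → Σ ℕ λ v → HasVal2 v (p ℚ.+ q)
val2-+-≢ {w} {q = q} (inj₁ refl) vq = w , subst (HasVal2 w) (sym (ℚP.+-identityˡ q)) vq
val2-+-≢ {w} (inj₂ (v , v≢w , vp)) vq with ℕP.<-cmp v w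
... | tri< v<w _ _ = v , val2-+-< v<w vp vq
... | tri≈ _ v≡w _ = ⊥-elim (v≢w v≡w)
... | tri> _ _ v>w = w , val2-+-> v>w vp vq

val2-Σ-distinct : ∀ n (f : Fin n → ℚ) (e : Fin n → ℕ) → (∀ i → HasVal2 (e i) (f i)) →
                  (∀ i j → e i ≡ e j → i ≡ j) →
                  ZeroOrVal2 (λ v → Σ (Fin n) λ i → v ≡ e i) (Σℚ n f)
val2-Σ-distinct zero    f e vf distinct = inj₁ refl
val2-Σ-distinct (suc n) f e vf distinct
  with val2-Σ-distinct n (f ∘ suc) (e ∘ suc) (vf ∘ suc) (λ i j eq → FP.suc-injective (distinct (suc i) (suc j) eq))
... | inj₁ rest≡0 = inj₂ (e zero , (zero , refl) , subst (HasVal2 (e zero)) (sym f₀+rest≡f₀) (vf zero))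
  where
  f₀+rest≡f₀ : f zero ℚ.+ Σℚ n (f ∘ suc) ≡ f zero
  f₀+rest≡f₀ = trans (cong (f zero ℚ.+_) rest≡0) (ℚP.+-identityʳ (f zero))
... | inj₂ (v , (i , refl) , vrest) with ℕP.<-cmp (e zero) (e (suc i))
...   | tri< lt _ _ = inj₂ (e zero , (zero , refl) , val2-+-< lt (vf zero) vrest)
...   | tri≈ _ eq _ = contradiction (distinct zero (suc i) eq) λ ()
...   | tri> _ _ gt = inj₂ (e (suc i) , (suc i , refl) , val2-+-> gt (vf zero) vrest)

+odd : ∀ c → + suc (2 ℕ.* c) ≡ Odd (+ c)
+odd c = cong (λ x → 1ℤ + x) (ℤP.pos-* 2 c)

data Parity : ℕ → Set where
  even : ∀ h → Parity (2 ℕ.* h)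
  odd  : ∀ h → Parity (suc (2 ℕ.* h))

parity : ∀ n → Parity n
parity zero = even 0
parity (suc n) with parity n
... | even h = odd h
... | odd h  = subst Parity (cong suc (ℕP.+-suc h (h ℕ.+ 0))) (even (suc h))

-- Every positive integer is 2^e times an odd number (by strong induction: the
-- even number 2(h+1) is handled through h+1).
OddPart : ℕ → Set
OddPart n = Σ ℕ λ e → Σ ℕ λ c → n ≡ 2 ^ e ℕ.* suc (2 ℕ.* c)

oddPart : ∀ n → OddPart (suc n)
oddPart = <-rec (λ n → OddPart (suc n)) step
  where
  step : ∀ n → (∀ {m} → m < n → OddPart (suc m)) → OddPart (suc n)
  step n rec with parity n
  ... | even h = 0 , h , sym (ℕP.*-identityˡ _)
  ... | odd h  with rec {h} (s≤s (ℕP.m≤m+n h (h ℕ.+ 0)))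
  ...   | e , c , h+1≡ = suc e , c , (begin
    suc (suc (2 ℕ.* h))                ≡⟨ cong suc (ℕP.+-suc h (h ℕ.+ 0)) ⟨
    2 ℕ.* suc h                        ≡⟨ cong (2 ℕ.*_) h+1≡ ⟩
    2 ℕ.* (2 ^ e ℕ.* suc (2 ℕ.* c))    ≡⟨ ℕP.*-assoc 2 (2 ^ e) _ ⟨
    2 ^ suc e ℕ.* suc (2 ℕ.* c)        ∎)

-- The 2-adic valuation of a natural number (with the arbitrary value ν₂ 0 = 0).
ν₂ : ℕ → ℕ
ν₂ zero    = 0
ν₂ (suc n) = proj₁ (oddPart n)

val2-toℚ : ∀ n → 1 ≤ n → HasVal2 (ν₂ n) (toℚ n)
val2-toℚ (suc n) _ = val2 (+ c) 0 0ℤ (≐-num numerator (toℚ-≐ (suc n))) refl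
  where
  e = proj₁ (oddPart n)
  c = proj₁ (proj₂ (oddPart n))
  numerator : + suc n ≡ Odd (+ c) * pow2 e
  numerator = begin
    + suc n                          ≡⟨ cong +_ (proj₂ (proj₂ (oddPart n))) ⟩
    + (2 ^ e ℕ.* suc (2 ℕ.* c))      ≡⟨ ℤP.pos-* (2 ^ e) _ ⟩
    pow2 e * + suc (2 ℕ.* c)         ≡⟨ cong (pow2 e *_) (+odd c) ⟩
    pow2 e * Odd (+ c)               ≡⟨ ℤP.*-comm (pow2 e) _ ⟩
    Odd (+ c) * pow2 e               ∎

val2-coef : ∀ j → HasVal2 (suc j) (coef j)
val2-coef j = val2 0ℤ _ (+ t) (≐-num (sym (ℤP.*-identityˡ _)) (≐-/ (+ 2 ^ suc j) _ {{pow2-1-nonZero j}})) oddDen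
  where
  t = 2 ^ j ∸ 1
  2^j≡1+t : 2 ^ j ≡ suc t
  2^j≡1+t = sym (ℕP.m+[n∸m]≡n (ℕP.m^n>0 2 j))
  oddDen : + suc (ℕ.pred (2 ^ suc j ∸ 1)) ≡ Odd (+ t)
  oddDen = begin
    + suc (ℕ.pred (2 ^ suc j ∸ 1))  ≡⟨ cong +_ (ℕP.suc-pred _ {{pow2-1-nonZero j}}) ⟩
    + (2 ℕ.* 2 ^ j ∸ 1)             ≡⟨ cong (λ x → + (2 ℕ.* x ∸ 1)) 2^j≡1+t ⟩
    + (2 ℕ.* suc t ∸ 1)             ≡⟨ cong +_ (ℕP.+-suc t (t ℕ.+ 0)) ⟩
    + suc (2 ℕ.* t)                 ≡⟨ +odd t ⟩
    Odd (+ t)                       ∎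

shift-mod-injective : ∀ k .{{_ : NonZero k}} {a b v w} → a < k → b < k →
                      v % k ≡ w % k → a ℕ.+ v ≡ b ℕ.+ w → a ≡ b
shift-mod-injective k {a} {b} {v} {w} a<k b<k v≡w a+v≡b+w = begin
  a                       ≡⟨ m<n⇒m%n≡m a<k ⟨
  a % k                   ≡⟨ [m+kn]%n≡m%n a (v / k) k ⟨
  (a ℕ.+ v / k ℕ.* k) % k ≡⟨ cong (_% k) quotients ⟩
  (b ℕ.+ w / k ℕ.* k) % k ≡⟨ [m+kn]%n≡m%n b (w / k) k ⟩
  b % k                   ≡⟨ m<n⇒m%n≡m b<k ⟩
  b                       ∎
  where
  split : ∀ a v → a ℕ.+ v ≡ (a ℕ.+ v / k ℕ.* k) ℕ.+ v % k
  split a v = begin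
    a ℕ.+ v                          ≡⟨ cong (a ℕ.+_) (m≡m%n+[m/n]*n v k) ⟩
    a ℕ.+ (v % k ℕ.+ v / k ℕ.* k)    ≡⟨ cong (a ℕ.+_) (ℕP.+-comm (v % k) _) ⟩
    a ℕ.+ (v / k ℕ.* k ℕ.+ v % k)    ≡⟨ ℕP.+-assoc a _ _ ⟨
    (a ℕ.+ v / k ℕ.* k) ℕ.+ v % k    ∎
  quotients : a ℕ.+ v / k ℕ.* k ≡ b ℕ.+ w / k ℕ.* k
  quotients = ℕP.+-cancelʳ-≡ (v % k) _ _ (begin
    (a ℕ.+ v / k ℕ.* k) ℕ.+ v % k    ≡⟨ split a v ⟨
    a ℕ.+ v                          ≡⟨ a+v≡b+w ⟩
    b ℕ.+ w                          ≡⟨ split b w ⟩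
    (b ℕ.+ w / k ℕ.* k) ℕ.+ w % k    ≡⟨ cong ((b ℕ.+ w / k ℕ.* k) ℕ.+_) v≡w ⟨
    (b ℕ.+ w / k ℕ.* k) ℕ.+ v % k    ∎)

val2-1 : HasVal2 0 1ℚ
val2-1 = val2 0ℤ 0 0ℤ (*≡* refl) refl

val2Colouring : (k : ℕ) .{{_ : NonZero k}} → ℕ → Fin k
val2Colouring k n = ν₂ n mod k

no-val2-congruent-solution : ∀ m (x : Fin (suc m) → ℕ) → (∀ i → 1 ≤ x i) → IsSolutionL m x →
                             (∀ i → ν₂ (x i) % suc m ≡ ν₂ (x zero) % suc m) → ⊥
no-val2-congruent-solution m x pos sol congruent = val2⇒≢0 (proj₂ val2-difference) difference≡0
  where
  k = suc m
  v : Fin (suc m) → ℕ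
  v i = ν₂ (x i)
  LHS = Σℚ m (λ i → coef (toℕ i) ℚ.* toℚ (x (suc i)))
  S   = Σℚ m (λ i → coef (toℕ i))
  RHS = (ℚ.- 1ℚ ℚ.+ S) ℚ.* toℚ (x zero)
  -- valuation of the i-th left-hand term
  e : Fin m → ℕ
  e i = suc (toℕ i) ℕ.+ v (suc i)
  toℕ-suc-injective : ∀ {n} {i j : Fin n} → suc (toℕ i) ≡ suc (toℕ j) → i ≡ j
  toℕ-suc-injective eq = FP.toℕ-injective (ℕP.suc-injective eq)
  e-injective : ∀ i j → e i ≡ e j → i ≡ j
  e-injective i j eq = toℕ-suc-injective
    (shift-mod-injective k (s≤s (FP.toℕ<n i)) (s≤s (FP.toℕ<n j))
       (trans (congruent (suc i)) (sym (congruent (suc j)))) eq)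
  e≢v₀ : ∀ i → e i ≢ v zero
  e≢v₀ i eq with shift-mod-injective k (s≤s (FP.toℕ<n i)) (s≤s z≤n) (congruent (suc i)) eq
  ... | ()
  LHS-val : ZeroOrVal2 (_≢ v zero) LHS
  LHS-val = zeroOrVal2-map (λ { (i , refl) → e≢v₀ i })
    (val2-Σ-distinct m _ e (λ i → val2-* (val2-coef (toℕ i)) (val2-toℚ _ (pos (suc i)))) e-injective)
  S-val : ZeroOrVal2 (0 <_) S
  S-val = zeroOrVal2-map (λ { (i , refl) → s≤s z≤n })
    (val2-Σ-distinct m _ (suc ∘ toℕ) (val2-coef ∘ toℕ) (λ i j → toℕ-suc-injective))
  RHS-val : HasVal2 (v zero) (ℚ.- RHS)
  RHS-val = val2-neg (val2-* (val2-+-dominant (val2-neg val2-1) S-val) (val2-toℚ _ (pos zero)))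
  val2-difference : Σ ℕ λ w → HasVal2 w (LHS ℚ.+ ℚ.- RHS)
  val2-difference = val2-+-≢ LHS-val RHS-val
  difference≡0 : LHS ℚ.+ ℚ.- RHS ≡ 0ℚ
  difference≡0 = trans (cong (ℚ._+ ℚ.- RHS) sol) (ℚP.+-inverseʳ RHS)

notRegular : ∀ m → ¬ Regular m (suc m)
notRegular m isRegular with isRegular (val2Colouring (suc m))
... | x , pos , sol , mono = no-val2-congruent-solution m x pos sol congruent
  where
  congruent : ∀ i → ν₂ (x i) % suc m ≡ ν₂ (x zero) % suc m
  congruent i = begin
    ν₂ (x i) % suc m                    ≡⟨ FP.toℕ-fromℕ< _ ⟨
    toℕ (val2Colouring (suc m) (x i))    ≡⟨ cong toℕ (mono i) ⟩
    toℕ (val2Colouring (suc m) (x zero)) ≡⟨ FP.toℕ-fromℕ< _ ⟩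
    ν₂ (x zero) % suc m                 ∎

toℚ-+ : ∀ m n → toℚ (m ℕ.+ n) ≡ toℚ m ℚ.+ toℚ n
toℚ-+ m n = ≐-unique (toℚ-≐ (m ℕ.+ n)) (≐-+ (toℚ-≐ m) (toℚ-≐ n)) (*≡* (cong (_* 1ℤ) (begin
  + (m ℕ.+ n)           ≡⟨ ℤP.pos-+ m n ⟩
  + m + + n             ≡⟨ cong₂ _+_ (ℤP.*-identityʳ (+ m)) (ℤP.*-identityʳ (+ n)) ⟨
  + m * 1ℤ + + n * 1ℤ   ∎)))

toℚ-* : ∀ m n → toℚ (m ℕ.* n) ≡ toℚ m ℚ.* toℚ n
toℚ-* m n = ≐-unique (toℚ-≐ (m ℕ.* n)) (≐-* (toℚ-≐ m) (toℚ-≐ n)) (*≡* (cong (_* 1ℤ) (ℤP.pos-* m n)))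

/-*-cancel : ∀ i d .{{_ : NonZero d}} → (i ℚ./ d) ℚ.* toℚ d ≡ i ℚ./ 1
/-*-cancel i (suc d) = ≐-unique (≐-* (≐-/ i (suc d)) (toℚ-≐ (suc d))) (≐-/ i 1) (*≡* (begin
  i * + suc d * 1ℤ         ≡⟨ ℤP.*-identityʳ _ ⟩
  i * + suc d              ≡⟨ cong (λ n → i * + suc n) (ℕP.*-identityʳ d) ⟨
  i * + suc (d ℕ.* 1)      ∎))

-- The identity behind the positive part:
--   2^i/(2^i-1) · (2^(a+i) - 2^a) = 2^(a+i)   for i = j+1,
-- since 2^(a+i) - 2^a = 2^a (2^i - 1).
coef-gap : ∀ a j → coef j ℚ.* (toℚ (2 ^ (a ℕ.+ suc j)) ℚ.- toℚ (2 ^ a)) ≡ toℚ (2 ^ (a ℕ.+ suc j))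
coef-gap a j = begin
  c ℚ.* (toℚ B ℚ.- A)                  ≡⟨ cong (λ z → c ℚ.* (z ℚ.- A)) B-expand ⟩
  c ℚ.* (A ℚ.* (D ℚ.+ 1ℚ) ℚ.- A)       ≡⟨ distribute c A D ⟩
  A ℚ.* (c ℚ.* D)                      ≡⟨ cong (A ℚ.*_) (/-*-cancel (+ P) (P ∸ 1) {{pow2-1-nonZero j}}) ⟩
  A ℚ.* toℚ P                          ≡⟨ toℚ-* (2 ^ a) P ⟨
  toℚ (2 ^ a ℕ.* P)                    ≡⟨ cong toℚ (ℕP.^-distribˡ-+-* 2 a (suc j)) ⟨
  toℚ B                                ∎
  where
  P = 2 ^ suc j
  B = 2 ^ (a ℕ.+ suc j)
  c = coef j
  A = toℚ (2 ^ a)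
  D = toℚ (P ∸ 1)
  B-expand : toℚ B ≡ A ℚ.* (D ℚ.+ 1ℚ)
  B-expand = begin
    toℚ B                        ≡⟨ cong toℚ (ℕP.^-distribˡ-+-* 2 a (suc j)) ⟩
    toℚ (2 ^ a ℕ.* P)            ≡⟨ cong (λ n → toℚ (2 ^ a ℕ.* n)) (ℕP.m∸n+n≡m (ℕP.m^n>0 2 (suc j))) ⟨
    toℚ (2 ^ a ℕ.* (P ∸ 1 ℕ.+ 1)) ≡⟨ toℚ-* (2 ^ a) _ ⟩
    A ℚ.* toℚ (P ∸ 1 ℕ.+ 1)      ≡⟨ cong (A ℚ.*_) (toℚ-+ (P ∸ 1) 1) ⟩
    A ℚ.* (D ℚ.+ 1ℚ)             ∎
  distribute : ∀ c a d → c ℚ.* (a ℚ.* (d ℚ.+ 1ℚ) ℚ.- a) ≡ a ℚ.* (c ℚ.* d)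
  distribute = solve 3 (λ c a d → c :* (a :* (d :+ con 1ℚ) :- a) := a :* (c :* d)) refl
    where open +-*-Solver

pointAt : ∀ {X : Set} {n} → Fin n → X → X → Fin n → X
pointAt zero    a b zero    = a
pointAt zero    a b (suc t) = b
pointAt (suc J) a b zero    = b
pointAt (suc J) a b (suc t) = pointAt J a b t

pointAt-values : ∀ {X : Set} (P : X → Set) {a b} → P a → P b → ∀ {n} (J t : Fin n) → P (pointAt J a b t)
pointAt-values P pa pb zero    zero    = pa
pointAt-values P pa pb zero    (suc t) = pb
pointAt-values P pa pb (suc J) zero    = pb
pointAt-values P pa pb (suc J) (suc t) = pointAt-values P pa pb J t

Σ-*ʳ : ∀ n (c : Fin n → ℚ) y → Σℚ n (λ t → c t ℚ.* y) ≡ Σℚ n c ℚ.* y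
Σ-*ʳ zero    c y = sym (ℚP.*-zeroˡ y)
Σ-*ʳ (suc n) c y = begin
  c zero ℚ.* y ℚ.+ Σℚ n (λ t → c (suc t) ℚ.* y)  ≡⟨ cong (c zero ℚ.* y ℚ.+_) (Σ-*ʳ n (c ∘ suc) y) ⟩
  c zero ℚ.* y ℚ.+ Σℚ n (c ∘ suc) ℚ.* y          ≡⟨ ℚP.*-distribʳ-+ y (c zero) _ ⟨
  Σℚ (suc n) c ℚ.* y                              ∎

Σ-pointAt : ∀ {X : Set} (f : X → ℚ) n (J : Fin n) (c : Fin n → ℚ) a b →
            Σℚ n (λ t → c t ℚ.* f (pointAt J a b t)) ≡ Σℚ n c ℚ.* f b ℚ.+ c J ℚ.* (f a ℚ.- f b)
Σ-pointAt f (suc n) zero c a b = begin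
  c zero ℚ.* f a ℚ.+ Σℚ n (λ t → c (suc t) ℚ.* f b)   ≡⟨ cong (c zero ℚ.* f a ℚ.+_) (Σ-*ʳ n (c ∘ suc) (f b)) ⟩
  c zero ℚ.* f a ℚ.+ Σℚ n (c ∘ suc) ℚ.* f b           ≡⟨ regroup (c zero) (Σℚ n (c ∘ suc)) (f a) (f b) ⟩
  Σℚ (suc n) c ℚ.* f b ℚ.+ c zero ℚ.* (f a ℚ.- f b)   ∎
  where
  regroup : ∀ c₀ s x y → c₀ ℚ.* x ℚ.+ s ℚ.* y ≡ (c₀ ℚ.+ s) ℚ.* y ℚ.+ c₀ ℚ.* (x ℚ.- y)
  regroup = solve 4 (λ c₀ s x y → c₀ :* x :+ s :* y := (c₀ :+ s) :* y :+ c₀ :* (x :- y)) refl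
    where open +-*-Solver
Σ-pointAt f (suc n) (suc J) c a b = begin
  c zero ℚ.* f b ℚ.+ Σℚ n (λ t → c (suc t) ℚ.* f (pointAt J a b t))
    ≡⟨ cong (c zero ℚ.* f b ℚ.+_) (Σ-pointAt f n J (c ∘ suc) a b) ⟩
  c zero ℚ.* f b ℚ.+ (Σℚ n (c ∘ suc) ℚ.* f b ℚ.+ c (suc J) ℚ.* (f a ℚ.- f b))
    ≡⟨ regroup (c zero) (Σℚ n (c ∘ suc)) (f b) (c (suc J) ℚ.* (f a ℚ.- f b)) ⟩
  Σℚ (suc n) c ℚ.* f b ℚ.+ c (suc J) ℚ.* (f a ℚ.- f b) ∎
  where
  regroup : ∀ c₀ s y r → c₀ ℚ.* y ℚ.+ (s ℚ.* y ℚ.+ r) ≡ (c₀ ℚ.+ s) ℚ.* y ℚ.+ r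
  regroup = solve 4 (λ c₀ s y r → c₀ :* y :+ (s :* y :+ r) := (c₀ :+ s) :* y :+ r) refl
    where open +-*-Solver

twoPowerSolution : ∀ {m} → ℕ → Fin m → Fin (suc m) → ℕ
twoPowerSolution a J zero    = 2 ^ (a ℕ.+ suc (toℕ J))
twoPowerSolution a J (suc t) = pointAt J (2 ^ a) (2 ^ (a ℕ.+ suc (toℕ J))) t

twoPowerSolution-values : ∀ (P : ℕ → Set) {m} a (J : Fin m) → P (2 ^ a) → P (2 ^ (a ℕ.+ suc (toℕ J))) →
                          ∀ i → P (twoPowerSolution a J i)
twoPowerSolution-values P a J pa pb zero    = pb
twoPowerSolution-values P a J pa pb (suc t) = pointAt-values P pa pb J t

twoPowerSolution-solves : ∀ m a (J : Fin m) → IsSolutionL m (twoPowerSolution a J)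
twoPowerSolution-solves m a J = begin
  Σℚ m (λ t → c t ℚ.* toℚ (pointAt J (2 ^ a) (2 ^ b) t))  ≡⟨ Σ-pointAt toℚ m J c (2 ^ a) (2 ^ b) ⟩
  S ℚ.* B ℚ.+ c J ℚ.* (A ℚ.- B)                          ≡⟨ flip-gap S (c J) A B ⟩
  S ℚ.* B ℚ.- c J ℚ.* (B ℚ.- A)                          ≡⟨ cong (λ z → S ℚ.* B ℚ.- z) (coef-gap a (toℕ J)) ⟩
  S ℚ.* B ℚ.- B                                          ≡⟨ factor S B ⟩
  (ℚ.- 1ℚ ℚ.+ S) ℚ.* B                                   ∎
  where
  c : Fin m → ℚ
  c t = coef (toℕ t)
  b = a ℕ.+ suc (toℕ J)
  A = toℚ (2 ^ a)
  B = toℚ (2 ^ b)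
  S = Σℚ m c
  flip-gap : ∀ s c a b → s ℚ.* b ℚ.+ c ℚ.* (a ℚ.- b) ≡ s ℚ.* b ℚ.- c ℚ.* (b ℚ.- a)
  flip-gap = solve 4 (λ s c a b → s :* b :+ c :* (a :- b) := s :* b :- c :* (b :- a)) refl
    where open +-*-Solver
  factor : ∀ s b → s ℚ.* b ℚ.- b ≡ (ℚ.- 1ℚ ℚ.+ s) ℚ.* b
  factor = solve 2 (λ s b → s :* b :- b := (:- con 1ℚ :+ s) :* b) refl
    where open +-*-Solver

regular : ∀ m → Regular m m
regular m χ with FP.pigeonhole (ℕP.n<1+n m) (λ i → χ (2 ^ toℕ i))
... | i , j , i<j , sameColour =
  twoPowerSolution a J ,
  twoPowerSolution-values (1 ≤_) a J (ℕP.m^n>0 2 a) (ℕP.m^n>0 2 (a ℕ.+ suc (toℕ J))) ,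
  twoPowerSolution-solves m a J ,
  twoPowerSolution-values (λ y → χ y ≡ χ (2 ^ (a ℕ.+ suc (toℕ J)))) a J
    (subst (λ z → χ (2 ^ a) ≡ χ (2 ^ z)) (sym a+1+J≡j) sameColour) refl
  where
  a = toℕ i
  d = toℕ j ∸ suc a
  a+1+d≡j : a ℕ.+ suc d ≡ toℕ j
  a+1+d≡j = trans (ℕP.+-suc a d) (ℕP.m+[n∸m]≡n i<j)
  d<m : d < m
  d<m = ℕP.≤-trans (ℕP.m≤n+m (suc d) a) (subst (_≤ m) (sym a+1+d≡j) (ℕP.≤-pred (FP.toℕ<n j)))
  J : Fin m
  J = F.fromℕ< d<m
  a+1+J≡j : a ℕ.+ suc (toℕ J) ≡ toℕ j
  a+1+J≡j = trans (cong (λ z → a ℕ.+ suc z) (FP.toℕ-fromℕ< d<m)) a+1+d≡j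

theorem1 : (m : ℕ) → Regular m m × ¬ Regular m (suc m)
theorem1 m = regular m , notRegular m
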